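{- If $M\in\mathbb Z^{m\times n}$ is minimum, then each nonzero row and each nonzero column of $M$ begins with a negative entry.
   Context: On $\mathbb Z^n$ use the lexicographic order; the row-lex ordering on $\mathbb Z^{m\times n}$ is its lexicographic extension, viewing a matrix as the sequence of its rows. Two matrices are H-equivalent if one is obtained from the other by permuting and negating rows and columns. $M$ is minimum if it is the row-lex smallest element of its H-equivalence class. A vector begins with a negative entry if its first nonzero coordinate is negative. -}

module Defs where

open import Data.Nat using (ℕ) renaming (zero to nzero; suc to nsuc)
open import Data.Fin using (Fin; zero; suc; _<_)
open import Data.Fin.Permutation using (Permutation′; _⟨$⟩ʳ_)
open import Data.Integer using (ℤ; -_; 0ℤ) renaming (_<_ to _<ℤ_)
open import Data.Bool using (Bool; true; false)
open import Data.Product using (Σ; ∃; ∃-syntax; _×_)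
open import Data.Sum using (_⊎_)
open import Data.Empty using (⊥)
open import Level using (Level; _⊔_)
import Data.Unit.Polymorphic
import Data.Empty.Polymorphic
open import Relation.Binary.PropositionalEquality using (_≡_)

Matrix : ℕ → ℕ → Set
Matrix m n = Fin m → Fin n → ℤ

PwEq : ∀ {a ℓ} {A : Set a} (_≈_ : A → A → Set ℓ) {n : ℕ} → (Fin n → A) → (Fin n → A) → Set ℓ
PwEq _≈_ {nzero}  u v = Data.Unit.Polymorphic.⊤
PwEq _≈_ {nsuc n} u v = (u zero ≈ v zero) × PwEq _≈_ (λ i → u (suc i)) (λ i → v (suc i))

Lex< : ∀ {a ℓ₁ ℓ₂} {A : Set a} (_≈_ : A → A → Set ℓ₁) (_≺_ : A → A → Set ℓ₂)
       {n : ℕ} → (Fin n → A) → (Fin n → A) → Set (ℓ₁ ⊔ ℓ₂)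
Lex< _≈_ _≺_ {nzero}  u v = Data.Empty.Polymorphic.⊥
Lex< _≈_ _≺_ {nsuc n} u v =
  (u zero ≺ v zero) ⊎ ((u zero ≈ v zero) × Lex< _≈_ _≺_ (λ i → u (suc i)) (λ i → v (suc i)))

_<lex_ : ∀ {n} → (Fin n → ℤ) → (Fin n → ℤ) → Set
_<lex_ = Lex< _≡_ _<ℤ_

_≈row_ : ∀ {n} → (Fin n → ℤ) → (Fin n → ℤ) → Set
_≈row_ = PwEq _≡_

_<rowlex_ : ∀ {m n} → Matrix m n → Matrix m n → Set
_<rowlex_ = Lex< _≈row_ _<lex_

_≈mat_ : ∀ {m n} → Matrix m n → Matrix m n → Set
_≈mat_ = PwEq _≈row_

_≤rowlex_ : ∀ {m n} → Matrix m n → Matrix m n → Set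
A ≤rowlex B = (A <rowlex B) ⊎ (A ≈mat B)

sgn : Bool → ℤ → ℤ
sgn true  x = - x
sgn false x = x

act : ∀ {m n} → Permutation′ m → Permutation′ n → (Fin m → Bool) → (Fin n → Bool)
      → Matrix m n → Matrix m n
act σ τ r c M i j = sgn (r i) (sgn (c j) (M (σ ⟨$⟩ʳ i) (τ ⟨$⟩ʳ j)))

HEquiv : ∀ {m n} → Matrix m n → Matrix m n → Set
HEquiv {m} {n} A B =
  ∃[ σ ] ∃[ τ ] ∃[ r ] ∃[ c ] ((act {m} {n} σ τ r c A) ≈mat B)

Minimum : ∀ {m n} → Matrix m n → Set
Minimum M = ∀ B → HEquiv M B → M ≤rowlex B

BeginsNegative : ∀ {n} → (Fin n → ℤ) → Set
BeginsNegative v = ∃[ k ] ((∀ i → i < k → v i ≡ 0ℤ) × (v k <ℤ 0ℤ))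

Nonzero : ∀ {n} → (Fin n → ℤ) → Set
Nonzero v = ∃[ k ] (v k ≡ 0ℤ → ⊥)

row : ∀ {m n} → Matrix m n → Fin m → (Fin n → ℤ)
row M i j = M i j

col : ∀ {m n} → Matrix m n → Fin n → (Fin m → ℤ)
col M j i = M i j

{-# OPTIONS --safe #-}
-- If the first nonzero entry of row i (resp. column j) of M were positive, negating
-- that row (resp. column) would give an H-equivalent matrix which is row-lex smaller
-- than M: all rows above are unchanged (for a column, they vanish in column j), and
-- the first changed entry decreases.
module Submission where

open import Defs
open import Data.Bool using (Bool; false)
open import Data.Empty using (⊥-elim)
open import Data.Fin using (Fin; zero; suc; _<_; _≟_; inject; fromℕ<)
open import Data.Fin.Permutation using (id)
open import Data.Fin.Properties using (¬∀⟶∃¬-smallest; toℕ-injective; toℕ-inject; toℕ-fromℕ<)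
import Data.Fin.Properties as Fin
open import Data.Integer using (ℤ; -_; 0ℤ) renaming (_<_ to _<ℤ_)
open import Data.Integer.Properties using (<-cmp; <-irrefl; <-asym; <-trans; neg-mono-<)
import Data.Integer.Properties as ℤ
open import Data.Nat using (ℕ; z<s; s<s)
open import Data.Product using (_×_; _,_; ∃-syntax)
open import Data.Sum using (_⊎_; inj₁; inj₂; [_,_])
open import Function using (_∘_)
open import Relation.Binary using (tri<; tri≈; tri>)
open import Relation.Binary.PropositionalEquality using (_≡_; _≢_; refl; sym; trans; subst)
open import Relation.Nullary using (¬_; does; yes; no)
open import Relation.Nullary.Decidable using (dec-true)
import Data.Unit.Polymorphic as ⊤

module _ {a ℓ} {A : Set a} {_≈_ : A → A → Set ℓ} where

  PwEq-refl : (∀ {x} → x ≈ x) → ∀ {n} {u : Fin n → A} → PwEq _≈_ u u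
  PwEq-refl ≈-refl {ℕ.zero}  = ⊤.tt
  PwEq-refl ≈-refl {ℕ.suc n} = ≈-refl , PwEq-refl ≈-refl

  ¬PwEq-at : ∀ {n} {u v : Fin n → A} (k : Fin n) → ¬ (u k ≈ v k) → ¬ PwEq _≈_ u v
  ¬PwEq-at zero    uk≉vk (u₀≈v₀ , _) = uk≉vk u₀≈v₀
  ¬PwEq-at (suc k) uk≉vk (_ , u≈v)   = ¬PwEq-at k uk≉vk u≈v

module _ {a ℓ₁ ℓ₂} {A : Set a} {_≈_ : A → A → Set ℓ₁} {_≺_ : A → A → Set ℓ₂} where

  ¬Lex<-pointwise : ∀ {n} {u v : Fin n → A} → (∀ q → ¬ (u q ≺ v q)) → ¬ Lex< _≈_ _≺_ u v
  ¬Lex<-pointwise {ℕ.zero}  u⊀v ()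
  ¬Lex<-pointwise {ℕ.suc n} u⊀v (inj₁ u₀≺v₀)   = u⊀v zero u₀≺v₀
  ¬Lex<-pointwise {ℕ.suc n} u⊀v (inj₂ (_ , lt)) = ¬Lex<-pointwise (u⊀v ∘ suc) lt

  ¬Lex<-at : ∀ {n} {u v : Fin n → A} (k : Fin n) →
             (∀ q → q < k → ¬ (u q ≺ v q)) → ¬ (u k ≺ v k ⊎ u k ≈ v k) → ¬ Lex< _≈_ _≺_ u v
  ¬Lex<-at zero    _      uk≰vk (inj₁ u₀≺v₀)        = uk≰vk (inj₁ u₀≺v₀)
  ¬Lex<-at zero    _      uk≰vk (inj₂ (u₀≈v₀ , _))  = uk≰vk (inj₂ u₀≈v₀)
  ¬Lex<-at (suc k) before _     (inj₁ u₀≺v₀)        = before zero z<s u₀≺v₀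
  ¬Lex<-at (suc k) before uk≰vk (inj₂ (_ , lt))     =
    ¬Lex<-at k (λ q q<k → before (suc q) (s<s q<k)) uk≰vk lt

  ¬Lex≤-at : ∀ {n} {u v : Fin n → A} (k : Fin n) →
             (∀ q → q < k → ¬ (u q ≺ v q)) → ¬ (u k ≺ v k ⊎ u k ≈ v k) →
             ¬ (Lex< _≈_ _≺_ u v ⊎ PwEq _≈_ u v)
  ¬Lex≤-at k before uk≰vk = [ ¬Lex<-at k before uk≰vk , ¬PwEq-at k (uk≰vk ∘ inj₂) ]

≈mat-refl : ∀ {m n} {M : Matrix m n} → M ≈mat M
≈mat-refl = PwEq-refl (PwEq-refl refl)

Minimum⇒≤act : ∀ {m n} {M : Matrix m n} → Minimum M →
               ∀ σ τ r c → M ≤rowlex act σ τ r c M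
Minimum⇒≤act {M = M} min σ τ r c =
  min (act σ τ r c M) (σ , τ , r , c , ≈mat-refl)

BeginsPositive : ∀ {n} → (Fin n → ℤ) → Set
BeginsPositive v = ∃[ k ] ((∀ i → i < k → v i ≡ 0ℤ) × (0ℤ <ℤ v k))

firstNonzero : ∀ {n} (v : Fin n → ℤ) → Nonzero v →
               ∃[ k ] ((∀ i → i < k → v i ≡ 0ℤ) × v k ≢ 0ℤ)
firstNonzero v (k , vk≢0)
  with ¬∀⟶∃¬-smallest _ (λ i → v i ≡ 0ℤ) (λ i → v i ℤ.≟ 0ℤ) (λ v≡0 → vk≢0 (v≡0 k))
... | k′ , vk′≢0 , before =
  k′ , (λ i i<k′ → subst (λ i → v i ≡ 0ℤ) (inject-fromℕ< i<k′) (before (fromℕ< i<k′))) , vk′≢0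
  where
  inject-fromℕ< : ∀ {n} {i k : Fin n} (i<k : i < k) → inject (fromℕ< i<k) ≡ i
  inject-fromℕ< i<k = toℕ-injective (trans (toℕ-inject (fromℕ< i<k)) (toℕ-fromℕ< i<k))

Nonzero∧¬BeginsPositive⇒BeginsNegative : ∀ {n} {v : Fin n → ℤ} →
                                          Nonzero v → ¬ BeginsPositive v → BeginsNegative v
Nonzero∧¬BeginsPositive⇒BeginsNegative {v = v} nz ¬pos with firstNonzero v nz
... | k , before , vk≢0 with <-cmp (v k) 0ℤ
...   | tri< vk<0 _ _ = k , before , vk<0
...   | tri≈ _ vk≡0 _ = ⊥-elim (vk≢0 vk≡0)
...   | tri> _ _ vk>0 = ⊥-elim (¬pos (k , before , vk>0))

pos≰neg : ∀ {x} → 0ℤ <ℤ x → ¬ (x <ℤ - x ⊎ x ≡ - x)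
pos≰neg {x} 0<x = [ <-asym -x<x , (λ x≡-x → ℤ.<⇒≢ -x<x (sym x≡-x)) ]
  where
  -x<x : - x <ℤ x
  -x<x = <-trans (neg-mono-< 0<x) 0<x

≡⇒≮ : ∀ {x y} → y ≡ x → ¬ (x <ℤ y)
≡⇒≮ y≡x = <-irrefl (sym y≡x)

flip : ∀ {n} → Fin n → Fin n → Bool
flip i q = does (q ≟ i)

pos≰flipped : ∀ {n} (i : Fin n) {x} → 0ℤ <ℤ x →
              ¬ (x <ℤ sgn (flip i i) x ⊎ x ≡ sgn (flip i i) x)
pos≰flipped i rewrite dec-true (i ≟ i) refl = pos≰neg

sgn-flip-id : ∀ {n} (i q : Fin n) x → (q ≡ i → x ≡ 0ℤ) → sgn (flip i q) x ≡ x
sgn-flip-id i q x x≡0 with q ≟ i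
... | yes q≡i rewrite x≡0 q≡i = refl
... | no _                    = refl

negateRow : ∀ {m n} → Fin m → Matrix m n → Matrix m n
negateRow i = act id id (flip i) (λ _ → false)

negateCol : ∀ {m n} → Fin n → Matrix m n → Matrix m n
negateCol j = act id id (λ _ → false) (flip j)

BeginsPositive-row⇒≰negateRow : ∀ {m n} (M : Matrix m n) (i : Fin m) →
                      BeginsPositive (row M i) → ¬ (M ≤rowlex negateRow i M)
BeginsPositive-row⇒≰negateRow M i (k , zeros , 0<Mik) = ¬Lex≤-at i rowsAbove rowI
  where
  rowsAbove : ∀ q → q < i → ¬ (M q <lex negateRow i M q)
  rowsAbove q q<i = ¬Lex<-pointwise λ j →
    ≡⇒≮ (sgn-flip-id i q (M q j) (⊥-elim ∘ Fin.<⇒≢ q<i))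
  rowI : ¬ (M i <lex negateRow i M i ⊎ M i ≈row negateRow i M i)
  rowI = ¬Lex≤-at k (λ j j<k → ≡⇒≮ (sgn-flip-id i i (M i j) (λ _ → zeros j j<k)))
                    (pos≰flipped i 0<Mik)

BeginsPositive-col⇒≰negateCol : ∀ {m n} (M : Matrix m n) (j : Fin n) →
                      BeginsPositive (col M j) → ¬ (M ≤rowlex negateCol j M)
BeginsPositive-col⇒≰negateCol M j (k , zeros , 0<Mkj) = ¬Lex≤-at k rowsAbove rowK
  where
  rowsAbove : ∀ q → q < k → ¬ (M q <lex negateCol j M q)
  rowsAbove q q<k = ¬Lex<-pointwise λ j′ →
    ≡⇒≮ (sgn-flip-id j j′ (M q j′) λ { refl → zeros q q<k })
  rowK : ¬ (M k <lex negateCol j M k ⊎ M k ≈row negateCol j M k)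
  rowK = ¬Lex≤-at j (λ j′ j′<j → ≡⇒≮ (sgn-flip-id j j′ (M k j′) (⊥-elim ∘ Fin.<⇒≢ j′<j)))
                    (pos≰flipped j 0<Mkj)

lemma3p2 : (m n : ℕ) (M : Matrix m n) → Minimum M →
    ((i : Fin m) → Nonzero (row M i) → BeginsNegative (row M i)) ×
    ((j : Fin n) → Nonzero (col M j) → BeginsNegative (col M j))
lemma3p2 m n M min =
  (λ i nz → Nonzero∧¬BeginsPositive⇒BeginsNegative nz λ pos →
     BeginsPositive-row⇒≰negateRow M i pos (Minimum⇒≤act min id id (flip i) (λ _ → false))) ,
  (λ j nz → Nonzero∧¬BeginsPositive⇒BeginsNegative nz λ pos →
     BeginsPositive-col⇒≰negateCol M j pos (Minimum⇒≤act min id id (λ _ → false) (flip j)))
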